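{- Let $w$ be a permutation and let $r$ be the row reading word of $\mathrm{SD}(w)$. Then $P(w)=P(r)$.
   Context: Box-ball system (BBS): boxes are arranged in a row extending infinitely to the right, each box holds at most one ball, balls are labeled $1,\dots,n$. A permutation $w=w_1\cdots w_n$ gives the time-$0$ configuration with ball $w_i$ in the $i$-th of $n$ consecutive boxes. A BBS move moves ball $1$ to the nearest empty box to its right, then ball $2$, ..., then ball $n$. An increasing run is a maximal block of balls in consecutive boxes with labels increasing left to right; a soliton is an increasing run preserved by all subsequent BBS moves. After finitely many moves the system reaches a steady state in which all increasing runs are solitons with lengths weakly decreasing from right to left. $\mathrm{SD}(w)$ is the tableau whose $i$-th row (from the top) is the $i$-th soliton from the right in a steady-state configuration of the system started at $w$. The row reading word of a tableau is the concatenation of its rows from bottom to top, each read left to right. $P(\cdot)$ denotes the Robinson–Schensted insertion tableau. -}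

module Defs where

open import Data.Nat using (ℕ; zero; suc; _≤_; _<ᵇ_; _≡ᵇ_)
open import Data.Bool using (Bool; true; false; if_then_else_)
open import Data.Maybe using (Maybe; just; nothing)
open import Data.List using (List; []; _∷_; _++_; [_]; foldl; reverse; concat; map; length; upTo)
open import Data.List.Membership.Propositional using (_∈_)
open import Data.List.Relation.Binary.Permutation.Propositional using (_↭_)
open import Data.List.Relation.Unary.Linked using (Linked)
open import Data.Product using (_×_)
import Data.Product

IsPermutation : List ℕ → Set
IsPermutation w = w ↭ map suc (upTo (length w))

-- Box-ball system
-- A configuration is a finite list of boxes (positions 0,1,2,…);
-- every box beyond the end of the list is empty.

Config : Set
Config = List (Maybe ℕ)

place : ℕ → Config → Config
place k []              = just k ∷ []
place k (nothing ∷ c)   = just k ∷ c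
place k (just x ∷ c)    = just x ∷ place k c

moveBall : ℕ → Config → Config
moveBall k []             = []
moveBall k (nothing ∷ c)  = nothing ∷ moveBall k c
moveBall k (just x ∷ c)   =
  if x ≡ᵇ k then nothing ∷ place k c else just x ∷ moveBall k c

bbsMove : ℕ → Config → Config
bbsMove n c = foldl (λ d k → moveBall k d) c (map suc (upTo n))

initial : List ℕ → Config
initial w = map just w

configAt : List ℕ → ℕ → Config
configAt w zero    = initial w
configAt w (suc t) = bbsMove (length w) (configAt w t)

-- Increasing runs (maximal blocks of balls in consecutive boxes with
-- increasing labels), listed from left to right.

-- auxiliary: cur = current run (reversed), acc = finished runs
runsAux : List ℕ → List (List ℕ) → Config → List (List ℕ)
runsAux []          acc []              = acc
runsAux cur@(_ ∷ _) acc []              = reverse cur ∷ acc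
runsAux []          acc (nothing ∷ c)   = runsAux [] acc c
runsAux cur@(_ ∷ _) acc (nothing ∷ c)   = runsAux [] (reverse cur ∷ acc) c
runsAux []          acc (just x ∷ c)    = runsAux (x ∷ []) acc c
runsAux cur@(y ∷ _) acc (just x ∷ c)    =
  if y <ᵇ x then runsAux (x ∷ cur) acc c
            else runsAux (x ∷ []) (reverse cur ∷ acc) c

increasingRuns : Config → List (List ℕ)
increasingRuns c = reverse (runsAux [] [] c)

IsSolitonAt : List ℕ → ℕ → List ℕ → Set
IsSolitonAt w t run = ∀ s → t ≤ s → run ∈ increasingRuns (configAt w s)

LengthsWeaklyDecreasingRightToLeft : List (List ℕ) → Set
LengthsWeaklyDecreasingRightToLeft rs = Linked (λ a b → length a ≤ length b) rs

IsSteadyStateAt : List ℕ → ℕ → Set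
IsSteadyStateAt w t =
  (∀ run → run ∈ increasingRuns (configAt w t) → IsSolitonAt w t run)
  × LengthsWeaklyDecreasingRightToLeft (increasingRuns (configAt w t))

-- Tableaux (list of rows, top row first)

Tableau : Set
Tableau = List (List ℕ)

-- soliton decomposition read off a steady-state configuration:
-- the i-th row (from the top) is the i-th soliton from the right
SDfromConfig : Config → Tableau
SDfromConfig c = reverse (increasingRuns c)

rowReadingWord : Tableau → List ℕ
rowReadingWord T = concat (reverse T)

rowInsert : ℕ → List ℕ → List ℕ × Maybe ℕ
rowInsert x []       = (x ∷ [] Data.Product., nothing)
rowInsert x (y ∷ r)  = if x <ᵇ y then ((x ∷ r) Data.Product., just y) else step (rowInsert x r)
  where
  step : List ℕ × Maybe ℕ → List ℕ × Maybe ℕ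
  step (r' Data.Product., b) = (y ∷ r' Data.Product., b)

insertT : ℕ → Tableau → Tableau
insertT x []        = (x ∷ []) ∷ []
insertT x (r ∷ T)   with rowInsert x r
... | (r' Data.Product., nothing) = r' ∷ T
... | (r' Data.Product., just y)  = r' ∷ insertT y T

P : List ℕ → Tableau
P w = foldl (λ T x → insertT x T) [] w

module Submission where

-- P is constant on Knuth classes: inserting two words related by one elementary Knuth move into
-- a sorted row yields the same row, and bumped words that are equal or again one Knuth move apart.
-- It therefore suffices that a BBS move keeps the Knuth class of the word of a configuration (its
-- balls read from left to right). Scanned box by box, a move is a carrier algorithm: the lifted
-- balls form a sorted row, a ball x met in a box is row-inserted into it and the ball it bumps is
-- left in that box, and an empty box receives the smallest carried ball. As C x is Knuth equivalent
-- to (bumped ball) C′ for a sorted row C and its insertion C′, each box preserves the class of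
-- carrier ++ unscanned word. Finally, the row reading word of SD is the word of the configuration.

open import Defs
open import Data.Nat using (ℕ; zero; suc; _≤_; _<_; _≡ᵇ_; _<ᵇ_; z≤n; s≤s)
open import Data.Nat.Properties
open import Data.Nat.Induction using (<-wellFounded)
open import Induction.WellFounded using (Acc; acc)
open import Data.Bool using (true; false; T; if_then_else_)
open import Data.Maybe using (Maybe; just; nothing)
open import Data.List using (List; []; _∷_; _++_; foldl; length; map; upTo; concat; reverse; catMaybes; fromMaybe)
open import Data.List.Properties using (++-assoc; ++-identityʳ; foldl-++; map-upTo; unfold-reverse; concat-++; reverse-involutive)
open import Data.List.Membership.Propositional using (_∈_)
open import Data.List.Membership.Propositional.Properties using (∈-map⁺)
open import Data.List.Relation.Unary.All as All using (All; []; _∷_)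
import Data.List.Relation.Unary.All.Properties as All
open import Data.List.Relation.Unary.Any using (here; there)
open import Data.List.Relation.Unary.AllPairs as AllPairs using (AllPairs; []; _∷_)
open import Data.List.Relation.Unary.AllPairs.Properties using (applyUpTo⁺₁)
open import Data.List.Relation.Unary.Unique.Propositional using (Unique)
open import Data.List.Relation.Binary.Permutation.Propositional using (_↭_; ↭-isEquivalence; prep; swap; ↭-refl; ↭-sym; ↭-trans; ↭⇒↭ₛ)
open import Data.List.Relation.Binary.Permutation.Propositional.Properties using (∈-resp-↭)
import Relation.Binary.PropositionalEquality as ≡
open import Data.List.Relation.Binary.Permutation.Setoid.Properties (≡.setoid ℕ) using (Unique-resp-↭)
open import Data.Product using (_×_; _,_; proj₁; proj₂; map₂; ∃; ∃₂)
open import Data.Sum using (inj₁; inj₂)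
open import Data.Empty using (⊥-elim)
open import Function using (_∘_)
open import Relation.Nullary.Reflects using (ofʸ; ofⁿ)
open import Relation.Nullary.Decidable using (dec-true; dec-false)
open import Relation.Binary.Construct.Closure.Equivalence using (EqClosure)
import Relation.Binary.Construct.Closure.Equivalence as EqClosure
open import Relation.Binary.Construct.Closure.Reflexive using (ReflClosure; refl; [_])
import Relation.Binary.Construct.Closure.Reflexive as ReflClosure
open import Relation.Binary.Bundles using (Setoid)
import Relation.Binary.Construct.On as On
import Relation.Binary.Reasoning.Setoid as SetoidReasoning
open import Relation.Binary.PropositionalEquality using (_≡_; _≢_; refl; sym; trans; cong; subst; isEquivalence; module ≡-Reasoning)

-- Row insertion

Sorted : List ℕ → Set
Sorted = AllPairs _≤_

data RowInsertion (x : ℕ) : List ℕ → List ℕ → Maybe ℕ → Set where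
  append : RowInsertion x [] (x ∷ []) nothing
  bump   : ∀ {a R} → x < a → RowInsertion x (a ∷ R) (x ∷ R) (just a)
  pass   : ∀ {a R R′ b} → a ≤ x → RowInsertion x R R′ b → RowInsertion x (a ∷ R) (a ∷ R′) b

rowInsert-complete : ∀ x R → RowInsertion x R (proj₁ (rowInsert x R)) (proj₂ (rowInsert x R))
rowInsert-complete x []      = append
rowInsert-complete x (a ∷ R) with x <ᵇ a | <ᵇ-reflects-< x a
... | true  | ofʸ x<a = bump x<a
... | false | ofⁿ x≮a = pass (≮⇒≥ x≮a) (rowInsert-complete x R)

rowInsertion-exists : ∀ x R → ∃₂ (RowInsertion x R)
rowInsertion-exists x R = _ , _ , rowInsert-complete x R

rowInsertion-deterministic : ∀ {x R R₁ R₂ b₁ b₂} →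
  RowInsertion x R R₁ b₁ → RowInsertion x R R₂ b₂ → R₁ ≡ R₂ × b₁ ≡ b₂
rowInsertion-deterministic append       append       = refl , refl
rowInsertion-deterministic (bump _)     (bump _)     = refl , refl
rowInsertion-deterministic (bump x<a)   (pass a≤x _) = ⊥-elim (<⇒≱ x<a a≤x)
rowInsertion-deterministic (pass a≤x _) (bump x<a)   = ⊥-elim (<⇒≱ x<a a≤x)
rowInsertion-deterministic (pass _ d)   (pass _ e)   with rowInsertion-deterministic d e
... | refl , refl = refl , refl

rowInsert-sound : ∀ {x R R′ b} → RowInsertion x R R′ b → rowInsert x R ≡ (R′ , b)
rowInsert-sound {x} {R} d with rowInsertion-deterministic (rowInsert-complete x R) d
... | refl , refl = refl

bumped-greater : ∀ {x R R′ q} → RowInsertion x R R′ (just q) → x < q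
bumped-greater (bump x<q) = x<q
bumped-greater (pass _ d) = bumped-greater d

bumped∈row : ∀ {x R R′ q} → RowInsertion x R R′ (just q) → q ∈ R
bumped∈row (bump _)   = here refl
bumped∈row (pass _ d) = there (bumped∈row d)

inserted∈row : ∀ {x R R′ b} → RowInsertion x R R′ b → x ∈ R′
inserted∈row append     = here refl
inserted∈row (bump _)   = here refl
inserted∈row (pass _ d) = there (inserted∈row d)

rowInsertion-all : ∀ {P : ℕ → Set} {x R R′ b} → P x → All P R → RowInsertion x R R′ b → All P R′
rowInsertion-all px []         append     = px ∷ []
rowInsertion-all px (_ ∷ pR)   (bump _)   = px ∷ pR
rowInsertion-all px (pa ∷ pR)  (pass _ d) = pa ∷ rowInsertion-all px pR d

rowInsertion-sorted : ∀ {x R R′ b} → Sorted R → RowInsertion x R R′ b → Sorted R′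
rowInsertion-sorted []          append       = [] ∷ []
rowInsertion-sorted (a≤R ∷ sR)  (bump x<a)   = All.map (≤-trans (<⇒≤ x<a)) a≤R ∷ sR
rowInsertion-sorted (a≤R ∷ sR)  (pass a≤x d) = rowInsertion-all a≤x a≤R d ∷ rowInsertion-sorted sR d

-- Knuth equivalence

data KnuthMove : List ℕ → List ℕ → Set where
  yzx∼yxz : ∀ {x y z q} → x < y → y ≤ z → KnuthMove (y ∷ z ∷ x ∷ q) (y ∷ x ∷ z ∷ q)
  xzy∼zxy : ∀ {x y z q} → x ≤ y → y < z → KnuthMove (x ∷ z ∷ y ∷ q) (z ∷ x ∷ y ∷ q)
  _∷_     : ∀ {u v} a → KnuthMove u v → KnuthMove (a ∷ u) (a ∷ v)

infix 4 _≈ᴷ_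

_≈ᴷ_ : List ℕ → List ℕ → Set
_≈ᴷ_ = EqClosure KnuthMove

knuthMove-++⁺ˡ : ∀ p {u v} → KnuthMove u v → KnuthMove (p ++ u) (p ++ v)
knuthMove-++⁺ˡ []      k = k
knuthMove-++⁺ˡ (a ∷ p) k = a ∷ knuthMove-++⁺ˡ p k

knuthMove-++⁺ʳ : ∀ s {u v} → KnuthMove u v → KnuthMove (u ++ s) (v ++ s)
knuthMove-++⁺ʳ s (yzx∼yxz x<y y≤z) = yzx∼yxz x<y y≤z
knuthMove-++⁺ʳ s (xzy∼zxy x≤y y<z) = xzy∼zxy x≤y y<z
knuthMove-++⁺ʳ s (a ∷ k)           = a ∷ knuthMove-++⁺ʳ s k

knuthMove⇒↭ : ∀ {u v} → KnuthMove u v → u ↭ v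
knuthMove⇒↭ (yzx∼yxz {x} {y} {z} _ _) = prep y (swap z x ↭-refl)
knuthMove⇒↭ (xzy∼zxy {x} {y} {z} _ _) = swap x z ↭-refl
knuthMove⇒↭ (a ∷ k)                   = prep a (knuthMove⇒↭ k)

module ≈ᴷ = Setoid (EqClosure.setoid KnuthMove)
module ≈ᴷ-Reasoning = SetoidReasoning (EqClosure.setoid KnuthMove)

≈ᴷ⇒↭ : ∀ {u v} → u ≈ᴷ v → u ↭ v
≈ᴷ⇒↭ = EqClosure.fold ↭-isEquivalence knuthMove⇒↭

≈ᴷ-++⁺ˡ : ∀ p {u v} → u ≈ᴷ v → p ++ u ≈ᴷ p ++ v
≈ᴷ-++⁺ˡ p = EqClosure.gmap (p ++_) (knuthMove-++⁺ˡ p)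

≈ᴷ-++⁺ʳ : ∀ s {u v} → u ≈ᴷ v → u ++ s ≈ᴷ v ++ s
≈ᴷ-++⁺ʳ s = EqClosure.gmap (_++ s) (knuthMove-++⁺ʳ s)

sortedRow-slide : ∀ {x y Z} → Sorted Z → All (y ≤_) Z → x < y → y ∷ Z ++ x ∷ [] ≈ᴷ y ∷ x ∷ Z
sortedRow-slide {Z = []}    _          _         _   = ≈ᴷ.refl
sortedRow-slide {Z = _ ∷ _} (z≤Z ∷ sZ) (y≤z ∷ _) x<y =
  ≈ᴷ.trans (≈ᴷ-++⁺ˡ (_ ∷ []) (sortedRow-slide sZ z≤Z (<-≤-trans x<y y≤z)))
           (EqClosure.return (yzx∼yxz x<y y≤z))

rowInsertion-knuth : ∀ {x R R′ b} → Sorted R → RowInsertion x R R′ b → R ++ x ∷ [] ≈ᴷ fromMaybe b ++ R′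
rowInsertion-knuth _          append     = ≈ᴷ.refl
rowInsertion-knuth (a≤R ∷ sR) (bump x<a) = sortedRow-slide sR a≤R x<a
rowInsertion-knuth (_ ∷ sR)   (pass {a} {b = nothing} _ d) = ≈ᴷ-++⁺ˡ (a ∷ []) (rowInsertion-knuth sR d)
rowInsertion-knuth (_ ∷ sR)   (pass {a} {b = just _} a≤x d@(bump x<q)) =
  ≈ᴷ.trans (≈ᴷ-++⁺ˡ (a ∷ []) (rowInsertion-knuth sR d)) (EqClosure.return (xzy∼zxy a≤x x<q))
rowInsertion-knuth ((a≤c ∷ _) ∷ sR) (pass {a} {b = just _} _ d@(pass c≤x d′)) =
  ≈ᴷ.trans (≈ᴷ-++⁺ˡ (a ∷ []) (rowInsertion-knuth sR d))
           (EqClosure.return (xzy∼zxy a≤c (≤-<-trans c≤x (bumped-greater d′))))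

-- Insertion tableaux are constant on Knuth classes

data WordInsertion : List ℕ → List ℕ → List ℕ → List ℕ → Set where
  []  : ∀ {R} → WordInsertion [] R R []
  _∷_ : ∀ {x u R R₁ R₂ b β} →
        RowInsertion x R R₁ b → WordInsertion u R₁ R₂ β → WordInsertion (x ∷ u) R R₂ (fromMaybe b ++ β)

wordInsertion-exists : ∀ u R → ∃₂ (WordInsertion u R)
wordInsertion-exists []      R = R , [] , []
wordInsertion-exists (x ∷ u) R with rowInsertion-exists x R
... | R₁ , b , d with wordInsertion-exists u R₁
...   | R₂ , β , w = R₂ , fromMaybe b ++ β , d ∷ w

wordInsertion-++ : ∀ {u v R R₁ R₂ β γ} →
  WordInsertion u R R₁ β → WordInsertion v R₁ R₂ γ → WordInsertion (u ++ v) R R₂ (β ++ γ)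
wordInsertion-++ []                       w′ = w′
wordInsertion-++ (_∷_ {b = nothing} d w) w′ = d ∷ wordInsertion-++ w w′
wordInsertion-++ (_∷_ {b = just _} d w)  w′ = d ∷ wordInsertion-++ w w′

wordInsertion-pass : ∀ {r u R R′ β} → All (r ≤_) u → WordInsertion u R R′ β → WordInsertion u (r ∷ R) (r ∷ R′) β
wordInsertion-pass []          []      = []
wordInsertion-pass (r≤x ∷ r≤u) (d ∷ w) = pass r≤x d ∷ wordInsertion-pass r≤u w

wordInsertion-bumped-length : ∀ {u R R′ β} → WordInsertion u R R′ β → length β ≤ length u
wordInsertion-bumped-length []                      = z≤n
wordInsertion-bumped-length (_∷_ {b = nothing} _ w) = m≤n⇒m≤1+n (wordInsertion-bumped-length w)
wordInsertion-bumped-length (_∷_ {b = just _} _ w)  = s≤s (wordInsertion-bumped-length w)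

appends-after-append : ∀ {y z R R₁ R₂ b} → y ≤ z →
  RowInsertion y R R₁ nothing → RowInsertion z R₁ R₂ b → b ≡ nothing
appends-after-append y≤z append       (bump z<y)      = ⊥-elim (<⇒≱ z<y y≤z)
appends-after-append y≤z append       (pass _ append) = refl
appends-after-append y≤z (pass a≤y _) (bump z<a)      = ⊥-elim (<⇒≱ z<a (≤-trans a≤y y≤z))
appends-after-append y≤z (pass _ d)   (pass _ e)      = appends-after-append y≤z d e

bumps-increase : ∀ {y z R R₁ R₂ p q} → Sorted R → y ≤ z →
  RowInsertion y R R₁ (just p) → RowInsertion z R₁ R₂ (just q) → p ≤ q
bumps-increase _          y≤z (bump _)     (bump z<y)  = ⊥-elim (<⇒≱ z<y y≤z)
bumps-increase (p≤R ∷ _)  y≤z (bump _)     (pass _ e)  = All.lookup p≤R (bumped∈row e)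
bumps-increase _          y≤z (pass a≤y _) (bump z<a)  = ⊥-elim (<⇒≱ z<a (≤-trans a≤y y≤z))
bumps-increase (_ ∷ sR)   y≤z (pass _ d)   (pass _ e)  = bumps-increase sR y≤z d e

bumps-at-most : ∀ {y z R R′ b} → Sorted R → y < z → z ∈ R →
  RowInsertion y R R′ b → ∃ λ q → b ≡ just q × q ≤ z
bumps-at-most _         y<z ()          append
bumps-at-most _         y<z (here refl) (bump _)     = _ , refl , ≤-refl
bumps-at-most (a≤R ∷ _) y<z (there z∈R) (bump _)     = _ , refl , All.lookup a≤R z∈R
bumps-at-most _         y<z (here refl) (pass z≤y _) = ⊥-elim (<⇒≱ y<z z≤y)
bumps-at-most (_ ∷ sR)  y<z (there z∈R) (pass _ d)   = bumps-at-most sR y<z z∈R d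

data InsertAlike (R u v : List ℕ) : Set where
  alike : ∀ {R′ β γ} → WordInsertion u R R′ β → WordInsertion v R R′ γ →
          ReflClosure KnuthMove β γ → InsertAlike R u v

insertAlike-pass : ∀ {r R u v} → All (r ≤_) u → All (r ≤_) v → InsertAlike R u v → InsertAlike (r ∷ R) u v
insertAlike-pass r≤u r≤v (alike w w′ bumps) = alike (wordInsertion-pass r≤u w) (wordInsertion-pass r≤v w′) bumps

insertAlike-++ : ∀ {R u v} s → InsertAlike R u v → InsertAlike R (u ++ s) (v ++ s)
insertAlike-++ s (alike {R′} w w′ bumps) with wordInsertion-exists s R′
... | _ , γ , ws = alike (wordInsertion-++ w ws) (wordInsertion-++ w′ ws) (ReflClosure.map (knuthMove-++⁺ʳ γ) bumps)

yzx∼yxz-bumps-r≤y : ∀ {y z r R R₁ R₂ b₁ b₂} → Sorted R → y ≤ z → r ≤ y →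
  RowInsertion y R R₁ b₁ → RowInsertion z R₁ R₂ b₂ →
  ReflClosure KnuthMove (fromMaybe b₁ ++ fromMaybe b₂ ++ r ∷ []) (fromMaybe b₁ ++ r ∷ fromMaybe b₂ ++ [])
yzx∼yxz-bumps-r≤y {b₁ = nothing} {nothing} _  _   _   _  _  = refl
yzx∼yxz-bumps-r≤y {b₁ = nothing} {just _}  _  y≤z _   d₁ d₂ with appends-after-append y≤z d₁ d₂
... | ()
yzx∼yxz-bumps-r≤y {b₁ = just _}  {nothing} _  _   _   _  _  = refl
yzx∼yxz-bumps-r≤y {b₁ = just _}  {just _}  sR y≤z r≤y d₁ d₂ =
  [ yzx∼yxz (≤-<-trans r≤y (bumped-greater d₁)) (bumps-increase sR y≤z d₁ d₂) ]

yzx∼yxz-bumps-y<r : ∀ {y z r R R₂ b₂} → All (r ≤_) R → y < r → RowInsertion z R R₂ b₂ →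
  ReflClosure KnuthMove (r ∷ fromMaybe b₂ ++ y ∷ []) (r ∷ y ∷ fromMaybe b₂ ++ [])
yzx∼yxz-bumps-y<r {b₂ = nothing} _   _   _  = refl
yzx∼yxz-bumps-y<r {b₂ = just _}  r≤R y<r d₂ = [ yzx∼yxz y<r (All.lookup r≤R (bumped∈row d₂)) ]

yzx∼yxz-insertAlike : ∀ {x y z R} → Sorted R → x < y → y ≤ z →
  InsertAlike R (y ∷ z ∷ x ∷ []) (y ∷ x ∷ z ∷ [])
yzx∼yxz-insertAlike [] x<y y≤z =
  alike (append ∷ pass y≤z append ∷ bump x<y ∷ [])
        (append ∷ bump x<y ∷ pass (<⇒≤ (<-≤-trans x<y y≤z)) append ∷ []) refl
yzx∼yxz-insertAlike {x} {y} {z} {r ∷ R} (r≤R ∷ sR) x<y y≤z with ≤-<-connex r x | ≤-<-connex r y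
... | inj₁ r≤x | _ =
  insertAlike-pass (r≤y ∷ r≤z ∷ r≤x ∷ []) (r≤y ∷ r≤x ∷ r≤z ∷ []) (yzx∼yxz-insertAlike sR x<y y≤z)
  where r≤y = ≤-trans r≤x (<⇒≤ x<y)
        r≤z = ≤-trans r≤y y≤z
... | inj₂ x<r | inj₁ r≤y with rowInsertion-exists y R
...   | R₁ , _ , d₁ with rowInsertion-exists z R₁
...     | _ , _ , d₂ =
  alike (pass r≤y d₁ ∷ pass (≤-trans r≤y y≤z) d₂ ∷ bump x<r ∷ [])
        (pass r≤y d₁ ∷ bump x<r ∷ pass (<⇒≤ (<-≤-trans x<y y≤z)) d₂ ∷ [])
        (yzx∼yxz-bumps-r≤y sR y≤z r≤y d₁ d₂)
yzx∼yxz-insertAlike {x} {y} {z} {r ∷ R} (r≤R ∷ sR) x<y y≤z | inj₂ x<r | inj₂ y<r with rowInsertion-exists z R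
... | _ , _ , d₂ =
  alike (bump y<r ∷ pass y≤z d₂ ∷ bump x<y ∷ [])
        (bump y<r ∷ bump x<y ∷ pass (<⇒≤ (<-≤-trans x<y y≤z)) d₂ ∷ [])
        (yzx∼yxz-bumps-y<r r≤R y<r d₂)

xzy∼zxy-bumps-r≤z : ∀ {y z r R R₁ R₂ b₁ b₂} → Sorted R → All (r ≤_) R → r ≤ z → y < z →
  RowInsertion z R R₁ b₁ → RowInsertion y R₁ R₂ b₂ →
  ReflClosure KnuthMove (r ∷ fromMaybe b₁ ++ fromMaybe b₂ ++ []) (fromMaybe b₁ ++ r ∷ fromMaybe b₂ ++ [])
xzy∼zxy-bumps-r≤z sR r≤R r≤z y<z d₁ d₂ with bumps-at-most (rowInsertion-sorted sR d₁) y<z (inserted∈row d₁) d₂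
xzy∼zxy-bumps-r≤z {b₁ = nothing} _ _   _   _ _  _  | _ , refl , _   = refl
xzy∼zxy-bumps-r≤z {b₁ = just _}  _ r≤R r≤z _ d₁ d₂ | _ , refl , q≤z =
  [ xzy∼zxy (All.lookup (rowInsertion-all r≤z r≤R d₁) (bumped∈row d₂)) (≤-<-trans q≤z (bumped-greater d₁)) ]

xzy∼zxy-insertAlike : ∀ {x y z R} → Sorted R → x ≤ y → y < z →
  InsertAlike R (x ∷ z ∷ y ∷ []) (z ∷ x ∷ y ∷ [])
xzy∼zxy-insertAlike [] x≤y y<z =
  alike (append ∷ pass (≤-trans x≤y (<⇒≤ y<z)) append ∷ pass x≤y (bump y<z) ∷ [])
        (append ∷ bump (≤-<-trans x≤y y<z) ∷ pass x≤y append ∷ []) refl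
xzy∼zxy-insertAlike {x} {y} {z} {r ∷ R} (r≤R ∷ sR) x≤y y<z with ≤-<-connex r x | ≤-<-connex r z
... | inj₁ r≤x | _ =
  insertAlike-pass (r≤x ∷ r≤z ∷ r≤y ∷ []) (r≤z ∷ r≤x ∷ r≤y ∷ []) (xzy∼zxy-insertAlike sR x≤y y<z)
  where r≤y = ≤-trans r≤x x≤y
        r≤z = ≤-trans r≤y (<⇒≤ y<z)
... | inj₂ x<r | inj₁ r≤z with rowInsertion-exists z R
...   | R₁ , _ , d₁ with rowInsertion-exists y R₁
...     | _ , _ , d₂ =
  alike (bump x<r ∷ pass (≤-trans x≤y (<⇒≤ y<z)) d₁ ∷ pass x≤y d₂ ∷ [])
        (pass r≤z d₁ ∷ bump x<r ∷ pass x≤y d₂ ∷ [])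
        (xzy∼zxy-bumps-r≤z sR r≤R r≤z y<z d₁ d₂)
xzy∼zxy-insertAlike {x} {y} {z} {r ∷ []} (_ ∷ _) x≤y y<z | inj₂ x<r | inj₂ z<r =
  alike (bump x<r ∷ pass (≤-trans x≤y (<⇒≤ y<z)) append ∷ pass x≤y (bump y<z) ∷ [])
        (bump z<r ∷ bump (≤-<-trans x≤y y<z) ∷ pass x≤y append ∷ []) refl
xzy∼zxy-insertAlike {x} {y} {z} {r ∷ r₂ ∷ R} ((r≤r₂ ∷ _) ∷ _) x≤y y<z | inj₂ x<r | inj₂ z<r =
  alike (bump x<r ∷ pass (≤-trans x≤y (<⇒≤ y<z)) (bump (<-≤-trans z<r r≤r₂)) ∷ pass x≤y (bump y<z) ∷ [])
        (bump z<r ∷ bump (≤-<-trans x≤y y<z) ∷ pass x≤y (bump (<-trans y<z (<-≤-trans z<r r≤r₂))) ∷ [])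
        [ yzx∼yxz z<r r≤r₂ ]

knuthMove-insertAlike : ∀ {R u v} → Sorted R → KnuthMove u v → InsertAlike R u v
knuthMove-insertAlike sR (yzx∼yxz {q = q} x<y y≤z) = insertAlike-++ q (yzx∼yxz-insertAlike sR x<y y≤z)
knuthMove-insertAlike sR (xzy∼zxy {q = q} x≤y y<z) = insertAlike-++ q (xzy∼zxy-insertAlike sR x≤y y<z)
knuthMove-insertAlike {R} sR (a ∷ k) with rowInsertion-exists a R
... | R₁ , b , d with knuthMove-insertAlike (rowInsertion-sorted sR d) k
...   | alike w w′ bumps = alike (d ∷ w) (d ∷ w′) (ReflClosure.map (knuthMove-++⁺ˡ (fromMaybe b)) bumps)

insertAll : List ℕ → Tableau → Tableau
insertAll u T = foldl (λ T x → insertT x T) T u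

insertT-cons : ∀ {x R R′ b} T → RowInsertion x R R′ b → insertT x (R ∷ T) ≡ R′ ∷ insertAll (fromMaybe b) T
insertT-cons {b = nothing} T d rewrite rowInsert-sound d = refl
insertT-cons {b = just _}  T d rewrite rowInsert-sound d = refl

insertAll-cons : ∀ {u R R′ β} T → WordInsertion u R R′ β → insertAll u (R ∷ T) ≡ R′ ∷ insertAll β T
insertAll-cons T [] = refl
insertAll-cons {x ∷ u} {R} {R′} T (_∷_ {R₁ = R₁} {b = b} {β = β} d w) = begin
  insertAll u (insertT x (R ∷ T))                   ≡⟨ cong (insertAll u) (insertT-cons T d) ⟩
  insertAll u (R₁ ∷ insertAll (fromMaybe b) T)      ≡⟨ insertAll-cons _ w ⟩
  R′ ∷ insertAll β (insertAll (fromMaybe b) T)      ≡⟨ cong (R′ ∷_) (sym (foldl-++ _ T (fromMaybe b) β)) ⟩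
  R′ ∷ insertAll (fromMaybe b ++ β) T               ∎
  where open ≡-Reasoning

-- P (x ∷ u) is the first row on top of P of the bumped word, which is shorter than x ∷ u.
P-knuthMove : ∀ {u v} → Acc _<_ (length u) → KnuthMove u v → P u ≡ P v
P-knuthMove _ k with knuthMove-insertAlike [] k
P-knuthMove _ () | alike [] _ _
P-knuthMove _ () | alike (_ ∷ _) [] _
P-knuthMove _ _ | alike (append ∷ w) (append ∷ w′) refl = trans (insertAll-cons [] w) (sym (insertAll-cons [] w′))
P-knuthMove {x ∷ u} {y ∷ v} (acc rs) _ | alike {R′} {β} {γ} (append ∷ w) (append ∷ w′) [ k′ ] = begin
  P (x ∷ u)  ≡⟨ insertAll-cons [] w ⟩
  R′ ∷ P β   ≡⟨ cong (R′ ∷_) (P-knuthMove (rs (s≤s (wordInsertion-bumped-length w))) k′) ⟩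
  R′ ∷ P γ   ≡⟨ sym (insertAll-cons [] w′) ⟩
  P (y ∷ v)  ∎
  where open ≡-Reasoning

P-resp-≈ᴷ : ∀ {u v} → u ≈ᴷ v → P u ≡ P v
P-resp-≈ᴷ = EqClosure.fold (On.isEquivalence P isEquivalence) (λ {u} → P-knuthMove (<-wellFounded (length u)))

-- A BBS move preserves the Knuth class of the word

≡ᵇ-false : ∀ {m n} → m ≢ n → (m ≡ᵇ n) ≡ false
≡ᵇ-false {m} {n} = dec-false (m ≟ n)

≡ᵇ-true⇒≡ : ∀ {m n} → (m ≡ᵇ n) ≡ true → m ≡ n
≡ᵇ-true⇒≡ {m} {n} eq = ≡ᵇ⇒≡ m n (subst T (sym eq) _)

-- A BBS move in progress while the boxes are scanned from the left: the pending action of ball k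
-- is move k before the scan reaches it, carry k once it is lifted (it goes to the next empty box)
-- and skip k once it has been put down. Labels stay increasing: balls move in label order.
data Action : Set where
  move carry skip : ℕ → Action

label : Action → ℕ
label (move k)  = k
label (carry k) = k
label (skip k)  = k

labels : List Action → List ℕ
labels = map label

act : Action → Config → Config
act (move k)  c = moveBall k c
act (carry k) c = place k c
act (skip _)  c = c

perform : List Action → Config → Config
perform []       c = c
perform (a ∷ as) c = perform as (act a c)

carrier : List Action → List ℕ
carrier []             = []
carrier (move _ ∷ as)  = carrier as
carrier (carry k ∷ as) = k ∷ carrier as
carrier (skip _ ∷ as)  = carrier as

fillEmptyBox : List Action → Maybe ℕ × List Action
fillEmptyBox []             = nothing , []
fillEmptyBox (move k ∷ as)  = map₂ (move k ∷_) (fillEmptyBox as)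
fillEmptyBox (carry k ∷ as) = just k , skip k ∷ as
fillEmptyBox (skip k ∷ as)  = map₂ (skip k ∷_) (fillEmptyBox as)

visitBall : ℕ → List Action → Maybe ℕ × List Action
visitBall x []             = just x , []
visitBall x (move k ∷ as)  =
  if x ≡ᵇ k then map₂ (carry k ∷_) (fillEmptyBox as) else map₂ (move k ∷_) (visitBall x as)
visitBall x (carry k ∷ as) = map₂ (carry k ∷_) (visitBall x as)
visitBall x (skip k ∷ as)  = map₂ (skip k ∷_) (visitBall x as)

perform-past : ∀ {x} as d → All (x ≢_) (labels as) → perform as (just x ∷ d) ≡ just x ∷ perform as d
perform-past []             d []          = refl
perform-past (move k ∷ as)  d (x≢k ∷ x∉) rewrite ≡ᵇ-false x≢k = perform-past as (moveBall k d) x∉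
perform-past (carry k ∷ as) d (_ ∷ x∉)   = perform-past as (place k d) x∉
perform-past (skip _ ∷ as)  d (_ ∷ x∉)   = perform-past as d x∉

perform-fillEmptyBox : ∀ as d → AllPairs _<_ (labels as) →
  perform as (nothing ∷ d) ≡ proj₁ (fillEmptyBox as) ∷ perform (proj₂ (fillEmptyBox as)) d
perform-fillEmptyBox []             d _          = refl
perform-fillEmptyBox (move k ∷ as)  d (_ ∷ inc)  = perform-fillEmptyBox as (moveBall k d) inc
perform-fillEmptyBox (carry k ∷ as) d (k< ∷ _)   = perform-past as d (All.map <⇒≢ k<)
perform-fillEmptyBox (skip _ ∷ as)  d (_ ∷ inc)  = perform-fillEmptyBox as d inc

perform-visitBall : ∀ x as d → AllPairs _<_ (labels as) →
  perform as (just x ∷ d) ≡ proj₁ (visitBall x as) ∷ perform (proj₂ (visitBall x as)) d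
perform-visitBall x []             d _         = refl
perform-visitBall x (move k ∷ as)  d (_ ∷ inc) with x ≡ᵇ k
... | true  = perform-fillEmptyBox as (place k d) inc
... | false = perform-visitBall x as (moveBall k d) inc
perform-visitBall x (carry k ∷ as) d (_ ∷ inc) = perform-visitBall x as (place k d) inc
perform-visitBall x (skip _ ∷ as)  d (_ ∷ inc) = perform-visitBall x as d inc

labels-fillEmptyBox : ∀ as → labels (proj₂ (fillEmptyBox as)) ≡ labels as
labels-fillEmptyBox []             = refl
labels-fillEmptyBox (move k ∷ as)  = cong (k ∷_) (labels-fillEmptyBox as)
labels-fillEmptyBox (carry k ∷ as) = refl
labels-fillEmptyBox (skip k ∷ as)  = cong (k ∷_) (labels-fillEmptyBox as)

labels-visitBall : ∀ x as → labels (proj₂ (visitBall x as)) ≡ labels as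
labels-visitBall x []             = refl
labels-visitBall x (move k ∷ as)  with x ≡ᵇ k
... | true  = cong (k ∷_) (labels-fillEmptyBox as)
... | false = cong (k ∷_) (labels-visitBall x as)
labels-visitBall x (carry k ∷ as) = cong (k ∷_) (labels-visitBall x as)
labels-visitBall x (skip k ∷ as)  = cong (k ∷_) (labels-visitBall x as)

carrier-fillEmptyBox : ∀ as → fromMaybe (proj₁ (fillEmptyBox as)) ++ carrier (proj₂ (fillEmptyBox as)) ≡ carrier as
carrier-fillEmptyBox []             = refl
carrier-fillEmptyBox (move _ ∷ as)  = carrier-fillEmptyBox as
carrier-fillEmptyBox (carry _ ∷ as) = refl
carrier-fillEmptyBox (skip _ ∷ as)  = carrier-fillEmptyBox as

carrier-all : ∀ {P : ℕ → Set} as → All P (labels as) → All P (carrier as)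
carrier-all []             []         = []
carrier-all (move _ ∷ as)  (_ ∷ ps)   = carrier-all as ps
carrier-all (carry _ ∷ as) (pk ∷ ps)  = pk ∷ carrier-all as ps
carrier-all (skip _ ∷ as)  (_ ∷ ps)   = carrier-all as ps

carrier-sorted : ∀ as → AllPairs _<_ (labels as) → Sorted (carrier as)
carrier-sorted []             []         = []
carrier-sorted (move _ ∷ as)  (_ ∷ inc)  = carrier-sorted as inc
carrier-sorted (carry _ ∷ as) (k< ∷ inc) = All.map <⇒≤ (carrier-all as k<) ∷ carrier-sorted as inc
carrier-sorted (skip _ ∷ as)  (_ ∷ inc)  = carrier-sorted as inc

fillEmptyBox-rowInsertion : ∀ {x} as → All (x <_) (labels as) →
  RowInsertion x (carrier as) (x ∷ carrier (proj₂ (fillEmptyBox as))) (proj₁ (fillEmptyBox as))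
fillEmptyBox-rowInsertion []             []        = append
fillEmptyBox-rowInsertion (move _ ∷ as)  (_ ∷ x<)  = fillEmptyBox-rowInsertion as x<
fillEmptyBox-rowInsertion (carry _ ∷ as) (x<k ∷ _) = bump x<k
fillEmptyBox-rowInsertion (skip _ ∷ as)  (_ ∷ x<)  = fillEmptyBox-rowInsertion as x<

visitBall-rowInsertion : ∀ {x} as → AllPairs _<_ (labels as) → move x ∈ as →
  RowInsertion x (carrier as) (carrier (proj₂ (visitBall x as))) (proj₁ (visitBall x as))
visitBall-rowInsertion {x} (move x ∷ as) (x< ∷ _) (here refl) rewrite dec-true (x ≟ x) refl =
  fillEmptyBox-rowInsertion as x<
visitBall-rowInsertion {x} (move k ∷ as) (k< ∷ inc) (there x∈)
  rewrite ≡ᵇ-false (<⇒≢ (All.lookup (All.map⁻ k<) x∈) ∘ sym) = visitBall-rowInsertion as inc x∈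
visitBall-rowInsertion (carry k ∷ as) (k< ∷ inc) (there x∈) =
  pass (<⇒≤ (All.lookup (All.map⁻ k<) x∈)) (visitBall-rowInsertion as inc x∈)
visitBall-rowInsertion (skip _ ∷ as)  (_ ∷ inc)  (there x∈) = visitBall-rowInsertion as inc x∈

∈-fillEmptyBox : ∀ {z} as → move z ∈ as → move z ∈ proj₂ (fillEmptyBox as)
∈-fillEmptyBox (move _ ∷ as)  (here refl) = here refl
∈-fillEmptyBox (move _ ∷ as)  (there z∈)  = there (∈-fillEmptyBox as z∈)
∈-fillEmptyBox (carry _ ∷ as) (there z∈)  = there z∈
∈-fillEmptyBox (skip _ ∷ as)  (there z∈)  = there (∈-fillEmptyBox as z∈)

∈-visitBall : ∀ {x z} as → z ≢ x → move z ∈ as → move z ∈ proj₂ (visitBall x as)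
∈-visitBall {x} (move k ∷ as) z≢x z∈ with x ≡ᵇ k in eq | z∈
... | true  | here refl = ⊥-elim (z≢x (sym (≡ᵇ-true⇒≡ eq)))
... | true  | there z∈′ = there (∈-fillEmptyBox as z∈′)
... | false | here refl = here refl
... | false | there z∈′ = there (∈-visitBall as z≢x z∈′)
∈-visitBall (carry _ ∷ as) z≢x (there z∈) = there (∈-visitBall as z≢x z∈)
∈-visitBall (skip _ ∷ as)  z≢x (there z∈) = there (∈-visitBall as z≢x z∈)

moveBall-map-just : ∀ {k} L → All (_≢ k) L → moveBall k (map just L) ≡ map just L
moveBall-map-just []      []          = refl
moveBall-map-just (l ∷ L) (l≢k ∷ L∌k) rewrite ≡ᵇ-false l≢k = cong (just l ∷_) (moveBall-map-just L L∌k)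

place-map-just : ∀ k L → place k (map just L) ≡ map just (L ++ k ∷ [])
place-map-just k []      = refl
place-map-just k (l ∷ L) = cong (just l ∷_) (place-map-just k L)

perform-map-just : ∀ as L → AllPairs _<_ (labels as) → All (λ l → All (l ≢_) (labels as)) L →
  perform as (map just L) ≡ map just (L ++ carrier as)
perform-map-just []             L _          _   = cong (map just) (sym (++-identityʳ L))
perform-map-just (move k ∷ as)  L (_ ∷ inc)  L∌  rewrite moveBall-map-just L (All.map All.head L∌) =
  perform-map-just as L inc (All.map All.tail L∌)
perform-map-just (carry k ∷ as) L (k< ∷ inc) L∌ rewrite place-map-just k L = begin
  perform as (map just (L ++ k ∷ []))
    ≡⟨ perform-map-just as (L ++ k ∷ []) inc (All.++⁺ (All.map All.tail L∌) (All.map <⇒≢ k< ∷ [])) ⟩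
  map just ((L ++ k ∷ []) ++ carrier as)  ≡⟨ cong (map just) (++-assoc L (k ∷ []) (carrier as)) ⟩
  map just (L ++ k ∷ carrier as)          ∎
  where open ≡-Reasoning
perform-map-just (skip _ ∷ as)  L (_ ∷ inc)  L∌  = perform-map-just as L inc (All.map All.tail L∌)

catMaybes-map-just : ∀ (L : List ℕ) → catMaybes (map just L) ≡ L
catMaybes-map-just []      = refl
catMaybes-map-just (l ∷ L) = cong (l ∷_) (catMaybes-map-just L)

catMaybes-∷ : ∀ (o : Maybe ℕ) c → catMaybes (o ∷ c) ≡ fromMaybe o ++ catMaybes c
catMaybes-∷ nothing  c = refl
catMaybes-∷ (just _) c = refl

perform-knuth : ∀ as d → AllPairs _<_ (labels as) →
  All (λ z → move z ∈ as) (catMaybes d) → Unique (catMaybes d) →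
  catMaybes (perform as d) ≈ᴷ carrier as ++ catMaybes d
perform-knuth as [] inc _ _ = ≈ᴷ.reflexive (begin
  catMaybes (perform as (map just []))  ≡⟨ cong catMaybes (perform-map-just as [] inc []) ⟩
  catMaybes (map just (carrier as))     ≡⟨ catMaybes-map-just (carrier as) ⟩
  carrier as                            ≡⟨ ++-identityʳ (carrier as) ⟨
  carrier as ++ []                      ∎)
  where open ≡-Reasoning
perform-knuth as (nothing ∷ d) inc pending unique = begin
  catMaybes (perform as (nothing ∷ d))       ≡⟨ cong catMaybes (perform-fillEmptyBox as d inc) ⟩
  catMaybes (o ∷ perform as′ d)              ≡⟨ catMaybes-∷ o (perform as′ d) ⟩
  fromMaybe o ++ catMaybes (perform as′ d)   ≈⟨ ≈ᴷ-++⁺ˡ (fromMaybe o) (perform-knuth as′ d inc′ pending′ unique) ⟩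
  fromMaybe o ++ carrier as′ ++ catMaybes d  ≡⟨ ++-assoc (fromMaybe o) _ _ ⟨
  (fromMaybe o ++ carrier as′) ++ catMaybes d ≡⟨ cong (_++ catMaybes d) (carrier-fillEmptyBox as) ⟩
  carrier as ++ catMaybes d                  ∎
  where
  open ≈ᴷ-Reasoning
  o   = proj₁ (fillEmptyBox as)
  as′ = proj₂ (fillEmptyBox as)
  inc′ = subst (AllPairs _<_) (sym (labels-fillEmptyBox as)) inc
  pending′ = All.map (∈-fillEmptyBox as) pending
perform-knuth as (just x ∷ d) inc (x∈ ∷ pending) (x∉ ∷ unique) = begin
  catMaybes (perform as (just x ∷ d))        ≡⟨ cong catMaybes (perform-visitBall x as d inc) ⟩
  catMaybes (o ∷ perform as′ d)              ≡⟨ catMaybes-∷ o (perform as′ d) ⟩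
  fromMaybe o ++ catMaybes (perform as′ d)   ≈⟨ ≈ᴷ-++⁺ˡ (fromMaybe o) (perform-knuth as′ d inc′ pending′ unique) ⟩
  fromMaybe o ++ carrier as′ ++ catMaybes d  ≡⟨ ++-assoc (fromMaybe o) _ _ ⟨
  (fromMaybe o ++ carrier as′) ++ catMaybes d
    ≈⟨ ≈ᴷ-++⁺ʳ (catMaybes d) (rowInsertion-knuth (carrier-sorted as inc) (visitBall-rowInsertion as inc x∈)) ⟨
  (carrier as ++ x ∷ []) ++ catMaybes d      ≡⟨ ++-assoc (carrier as) (x ∷ []) (catMaybes d) ⟩
  carrier as ++ x ∷ catMaybes d              ∎
  where
  open ≈ᴷ-Reasoning
  o   = proj₁ (visitBall x as)
  as′ = proj₂ (visitBall x as)
  inc′ = subst (AllPairs _<_) (sym (labels-visitBall x as)) inc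
  pending′ = All.zipWith (λ (z∈ , x≢z) → ∈-visitBall as (x≢z ∘ sym) z∈) (pending , x∉)

bbsMove-perform : ∀ ks c → foldl (λ d k → moveBall k d) c ks ≡ perform (map move ks) c
bbsMove-perform []       c = refl
bbsMove-perform (k ∷ ks) c = bbsMove-perform ks (moveBall k c)

labels-moves : ∀ ks → labels (map move ks) ≡ ks
labels-moves []       = refl
labels-moves (k ∷ ks) = cong (k ∷_) (labels-moves ks)

carrier-moves : ∀ ks → carrier (map move ks) ≡ []
carrier-moves []       = refl
carrier-moves (_ ∷ ks) = carrier-moves ks

balls-increasing : ∀ n → AllPairs _<_ (map suc (upTo n))
balls-increasing n = subst (AllPairs _<_) (sym (map-upTo suc n)) (applyUpTo⁺₁ suc n (λ i<j _ → s≤s i<j))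

bbsMove-knuth : ∀ n c → catMaybes c ↭ map suc (upTo n) → catMaybes (bbsMove n c) ≈ᴷ catMaybes c
bbsMove-knuth n c c↭balls = begin
  catMaybes (bbsMove n c)               ≡⟨ cong catMaybes (bbsMove-perform balls c) ⟩
  catMaybes (perform (map move balls) c) ≈⟨ perform-knuth (map move balls) c increasing pending unique ⟩
  carrier (map move balls) ++ catMaybes c ≡⟨ cong (_++ catMaybes c) (carrier-moves balls) ⟩
  catMaybes c                           ∎
  where
  open ≈ᴷ-Reasoning
  balls = map suc (upTo n)
  increasing = subst (AllPairs _<_) (sym (labels-moves balls)) (balls-increasing n)
  pending = All.tabulate (λ z∈ → ∈-map⁺ move (∈-resp-↭ c↭balls z∈))
  unique = Unique-resp-↭ (↭⇒↭ₛ (↭-sym c↭balls)) (AllPairs.map <⇒≢ (balls-increasing n))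

configAt-knuth : ∀ {w} → IsPermutation w → ∀ t → catMaybes (configAt w t) ≈ᴷ w
configAt-knuth {w} _     zero    = ≈ᴷ.reflexive (catMaybes-map-just w)
configAt-knuth {w} wPerm (suc t) =
  ≈ᴷ.trans (bbsMove-knuth (length w) (configAt w t) (↭-trans (≈ᴷ⇒↭ ih) wPerm)) ih
  where ih = configAt-knuth wPerm t

-- Reading word of the soliton decomposition

concat-reverse-∷ : ∀ (runs : List (List ℕ)) r s →
  concat (reverse (r ∷ runs)) ++ s ≡ concat (reverse runs) ++ r ++ s
concat-reverse-∷ runs r s = begin
  concat (reverse (r ∷ runs)) ++ s            ≡⟨ cong (λ rs → concat rs ++ s) (unfold-reverse r runs) ⟩
  concat (reverse runs ++ r ∷ []) ++ s        ≡⟨ cong (_++ s) (concat-++ (reverse runs) (r ∷ [])) ⟨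
  (concat (reverse runs) ++ r ++ []) ++ s     ≡⟨ cong (λ r′ → (concat (reverse runs) ++ r′) ++ s) (++-identityʳ r) ⟩
  (concat (reverse runs) ++ r) ++ s           ≡⟨ ++-assoc (concat (reverse runs)) r s ⟩
  concat (reverse runs) ++ r ++ s             ∎
  where open ≡-Reasoning

reverse-∷-++ : ∀ (x : ℕ) cur s → reverse (x ∷ cur) ++ s ≡ reverse cur ++ x ∷ s
reverse-∷-++ x cur s = trans (cong (_++ s) (unfold-reverse x cur)) (++-assoc (reverse cur) (x ∷ []) s)

runsAux-concat : ∀ cur runs c →
  concat (reverse (runsAux cur runs c)) ≡ concat (reverse runs) ++ reverse cur ++ catMaybes c
runsAux-concat []          runs []            = sym (++-identityʳ _)
runsAux-concat cur@(_ ∷ _) runs []            = trans (sym (++-identityʳ _)) (concat-reverse-∷ runs (reverse cur) [])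
runsAux-concat []          runs (nothing ∷ c) = runsAux-concat [] runs c
runsAux-concat cur@(_ ∷ _) runs (nothing ∷ c) =
  trans (runsAux-concat [] (reverse cur ∷ runs) c) (concat-reverse-∷ runs (reverse cur) (catMaybes c))
runsAux-concat []          runs (just x ∷ c)  = runsAux-concat (x ∷ []) runs c
runsAux-concat cur@(y ∷ _) runs (just x ∷ c)  with y <ᵇ x
... | true  = trans (runsAux-concat (x ∷ cur) runs c)
                    (cong (concat (reverse runs) ++_) (reverse-∷-++ x cur (catMaybes c)))
... | false = trans (runsAux-concat (x ∷ []) (reverse cur ∷ runs) c)
                    (concat-reverse-∷ runs (reverse cur) (x ∷ catMaybes c))

rowReadingWord-SD : ∀ c → rowReadingWord (SDfromConfig c) ≡ catMaybes c
rowReadingWord-SD c = trans (cong concat (reverse-involutive (reverse (runsAux [] [] c)))) (runsAux-concat [] [] c)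

corollary3p5 : (w : List ℕ) → IsPermutation w → (t : ℕ) → IsSteadyStateAt w t →
    P w ≡ P (rowReadingWord (SDfromConfig (configAt w t)))
corollary3p5 w wPerm t _ = begin
  P w                                                   ≡⟨ P-resp-≈ᴷ (≈ᴷ.sym (configAt-knuth wPerm t)) ⟩
  P (catMaybes (configAt w t))                          ≡⟨ cong P (rowReadingWord-SD (configAt w t)) ⟨
  P (rowReadingWord (SDfromConfig (configAt w t)))      ∎
  where open ≡-Reasoning
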